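{- Let $M,N$ be non-deterministic $\lambda$-terms with $M\rightsquigarrow N$, and let $t\in\mathcal T(N)$. Then there exists $s\in\mathcal T(M)$ such that $s\ge t$. If moreover the reduction $M\rightsquigarrow N$ is at top level, then there exists such an $s$ with $s>t$.
   Context: Non-deterministic $\lambda$-terms are given by $M::=x\mid\lambda x.M\mid (M)N\mid M+N$, taken up to $\alpha$-equivalence and the identities $M+N=N+M$, $(M+N)+P=M+(N+P)$, $\lambda x.(M+N)=\lambda x.M+\lambda x.N$, $(M+N)P=(M)P+(N)P$. $\beta$-reduction $\to_\beta$ is the contextual closure of $(\lambda x.M)N\to_\beta M[N/x]$. Let $\sqsubseteq$ be the least partial order on terms such that $M\sqsubseteq M+N$ and $N\sqsubseteq M+N$, and such that if $M\sqsubseteq N$ then $M+P\sqsubseteq N+P$, $\lambda x.M\sqsubseteq\lambda x.N$, $(M)P\sqsubseteq(N)P$ and $(P)M\sqsubseteq(P)N$. Partial reduction: $M\rightsquigarrow N$ if there is $P$ with $M\to_\beta P$ and $N\sqsubseteq P$. The partial reduction is at top level if $M=(\lambda x.M')M''$ and $N\sqsubseteq M'[M''/x]$. Resource terms $\Delta$ are given by $s::=x\mid\lambda x.s\mid\langle s\rangle\bar t$, with bags finite multisets; $a^!$ is the set of bags with elements in $a$. The Taylor support is defined by: - $\mathcal T(x)=\{x\}$; - $\mathcal T(\lambda x.M)=\{\lambda x.s:s\in\mathcal T(M)\}$; - $\mathcal T((M)N)=\{\langle s\rangle\bar t:s\in\mathcal T(M),\bar t\in\mathcal T(N)^!\}$;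 - $\mathcal T(M+N)=\mathcal T(M)\cup\mathcal T(N)$. Resource reduction $\to_r$ acts on finite formal sums with natural coefficients. It is generated by $\langle\lambda x.t\rangle[s_1,\dots,s_n]\to_r\sum_{f\in S_n}t[s_{f(1)}/x_1,\dots,s_{f(n)}/x_n]$ when $x_1,\dots,x_n$ are exactly the free occurrences of $x$ in $t$, and $\to_r 0$ otherwise. It is closed under constructors (extended linearly) and linearity. Write $s\ge t$ if $s\to_r^*a$ with $t$ in the support of $a$, and $s>t$ if $s\ge t$ and $s\ne t$. -}

module Defs where

open import Data.Nat using (ℕ; zero; suc; pred; _≡ᵇ_; _<ᵇ_; _≤ᵇ_)
open import Data.Bool using (Bool; true; false; if_then_else_)
open import Data.List using (List; []; _∷_; _++_; map; concatMap; length; [_])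
open import Data.List.Relation.Unary.All using (All)
open import Data.List.Relation.Unary.Any using (Any)
open import Data.Product using (Σ; _×_; _,_; proj₁; proj₂; ∃-syntax)
open import Relation.Nullary using (¬_)
open import Relation.Binary.Construct.Closure.ReflexiveTransitive using (Star)

-- Non-deterministic λ-terms (raw syntax, de Bruijn indices ⇒ α-equivalence
-- is syntactic equality).

infixl 6 _⊕_

data Term : Set where
  var : ℕ → Term
  lam : Term → Term
  app : Term → Term → Term
  _⊕_ : Term → Term → Term

shift : ℕ → Term → Term
shift c (var i)   = if c ≤ᵇ i then var (suc i) else var i
shift c (lam M)   = lam (shift (suc c) M)
shift c (app M N) = app (shift c M) (shift c N)
shift c (M ⊕ N)   = shift c M ⊕ shift c N

shiftN : ℕ → Term → Term
shiftN zero    M = M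
shiftN (suc k) M = shift 0 (shiftN k M)

-- substitution of N for the variable bound k binders up, removing that binder
subst : ℕ → Term → Term → Term
subst k N (var i)   = if i ≡ᵇ k then shiftN k N
                      else (if i <ᵇ k then var i else var (pred i))
subst k N (lam M)   = lam (subst (suc k) N M)
subst k N (app M P) = app (subst k N M) (subst k N P)
subst k N (M ⊕ P)   = subst k N M ⊕ subst k N P

-- M [ N /0] is M[N/x] where M is the body of λx.M
_[_/0] : Term → Term → Term
M [ N /0] = subst 0 N M

-- The identities defining the quotient: congruence generated by
-- commutativity/associativity of +, and linearity of λ and of application
-- in function position.
infix 4 _≃_
data _≃_ : Term → Term → Set where
  ≃-refl  : ∀ {M} → M ≃ M
  ≃-sym   : ∀ {M N} → M ≃ N → N ≃ M
  ≃-trans : ∀ {M N P} → M ≃ N → N ≃ P → M ≃ P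
  ≃-lam   : ∀ {M N} → M ≃ N → lam M ≃ lam N
  ≃-appL  : ∀ {M N P} → M ≃ N → app M P ≃ app N P
  ≃-appR  : ∀ {M N P} → M ≃ N → app P M ≃ app P N
  ≃-⊕L    : ∀ {M N P} → M ≃ N → M ⊕ P ≃ N ⊕ P
  ≃-⊕R    : ∀ {M N P} → M ≃ N → P ⊕ M ≃ P ⊕ N
  ≃-comm  : ∀ {M N} → M ⊕ N ≃ N ⊕ M
  ≃-assoc : ∀ {M N P} → (M ⊕ N) ⊕ P ≃ M ⊕ (N ⊕ P)
  ≃-lam⊕  : ∀ {M N} → lam (M ⊕ N) ≃ lam M ⊕ lam N
  ≃-app⊕  : ∀ {M N P} → app (M ⊕ N) P ≃ app M P ⊕ app N P

infix 4 _→β₀_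
data _→β₀_ : Term → Term → Set where
  β     : ∀ {M N} → app (lam M) N →β₀ M [ N /0]
  ξ-lam : ∀ {M N} → M →β₀ N → lam M →β₀ lam N
  ξ-appL : ∀ {M N P} → M →β₀ N → app M P →β₀ app N P
  ξ-appR : ∀ {M N P} → M →β₀ N → app P M →β₀ app P N
  ξ-⊕L  : ∀ {M N P} → M →β₀ N → M ⊕ P →β₀ N ⊕ P
  ξ-⊕R  : ∀ {M N P} → M →β₀ N → P ⊕ M →β₀ P ⊕ N

-- β-reduction on terms up to ≃ (i.e. on equivalence classes)
infix 4 _→β_
_→β_ : Term → Term → Set
M →β N = ∃[ M' ] ∃[ N' ] (M ≃ M' × M' →β₀ N' × N' ≃ N)

infix 4 _⊑_
data _⊑_ : Term → Term → Set where
  ⊑-≃     : ∀ {M N} → M ≃ N → M ⊑ N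
  ⊑-trans : ∀ {M N P} → M ⊑ N → N ⊑ P → M ⊑ P
  ⊑-inl   : ∀ {M N} → M ⊑ M ⊕ N
  ⊑-inr   : ∀ {M N} → N ⊑ M ⊕ N
  ⊑-⊕     : ∀ {M N P} → M ⊑ N → M ⊕ P ⊑ N ⊕ P
  ⊑-lam   : ∀ {M N} → M ⊑ N → lam M ⊑ lam N
  ⊑-appL  : ∀ {M N P} → M ⊑ N → app M P ⊑ app N P
  ⊑-appR  : ∀ {M N P} → M ⊑ N → app P M ⊑ app P N

infix 4 _⇝_
_⇝_ : Term → Term → Set
M ⇝ N = ∃[ P ] (M →β P × N ⊑ P)

TopLevel : Term → Term → Set
TopLevel M N = ∃[ M' ] ∃[ M'' ] (M ≃ app (lam M') M'' × N ⊑ M' [ M'' /0])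

-- Resource terms (de Bruijn); bags are lists taken up to permutation.

data RTerm : Set where
  rvar : ℕ → RTerm
  rlam : RTerm → RTerm
  rapp : RTerm → List RTerm → RTerm

-- equality of resource terms: bags compared as multisets
infix 4 _≈ᵣ_ _≈b_
mutual
  data _≈ᵣ_ : RTerm → RTerm → Set where
    rvar : ∀ {i} → rvar i ≈ᵣ rvar i
    rlam : ∀ {s t} → s ≈ᵣ t → rlam s ≈ᵣ rlam t
    rapp : ∀ {s t bs cs} → s ≈ᵣ t → bs ≈b cs → rapp s bs ≈ᵣ rapp t cs

  data _≈b_ : List RTerm → List RTerm → Set where
    []  : [] ≈b []
    _∷_ : ∀ {x xs y ys₁ ys₂} → x ≈ᵣ y → xs ≈b (ys₁ ++ ys₂) →
          (x ∷ xs) ≈b (ys₁ ++ y ∷ ys₂)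

mutual
  rshift : ℕ → RTerm → RTerm
  rshift c (rvar i)    = if c ≤ᵇ i then rvar (suc i) else rvar i
  rshift c (rlam s)    = rlam (rshift (suc c) s)
  rshift c (rapp s bs) = rapp (rshift c s) (rshiftB c bs)

  rshiftB : ℕ → List RTerm → List RTerm
  rshiftB c []       = []
  rshiftB c (b ∷ bs) = rshift c b ∷ rshiftB c bs

rshiftN : ℕ → RTerm → RTerm
rshiftN zero    s = s
rshiftN (suc k) s = rshift 0 (rshiftN k s)

mutual
  occ : ℕ → RTerm → ℕ
  occ k (rvar i)    = if i ≡ᵇ k then 1 else 0
  occ k (rlam s)    = occ (suc k) s
  occ k (rapp s bs) = occ k s Data.Nat.+ occB k bs

  occB : ℕ → List RTerm → ℕ
  occB k []       = 0
  occB k (b ∷ bs) = occ k b Data.Nat.+ occB k bs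

-- linear substitution: the successive (left-to-right) occurrences of the
-- variable bound k binders up are replaced by the successive elements of
-- the list; returns the result and the unused elements.
mutual
  lsub : ℕ → RTerm → List RTerm → RTerm × List RTerm
  lsub k (rvar i) us with i ≡ᵇ k
  lsub k (rvar i) []       | true = rvar i , []
  lsub k (rvar i) (u ∷ us) | true = rshiftN k u , us
  ... | false = (if i <ᵇ k then rvar i else rvar (pred i)) , us
  lsub k (rlam s) us with lsub (suc k) s us
  ... | s' , us' = rlam s' , us'
  lsub k (rapp s bs) us with lsub k s us
  ... | s' , us₁ with lsubB k bs us₁
  ... | bs' , us₂ = rapp s' bs' , us₂

  lsubB : ℕ → List RTerm → List RTerm → List RTerm × List RTerm
  lsubB k [] us = [] , us
  lsubB k (b ∷ bs) us with lsub k b us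
  ... | b' , us₁ with lsubB k bs us₁
  ... | bs' , us₂ = (b' ∷ bs') , us₂

insertions : {A : Set} → A → List A → List (List A)
insertions x []       = [ x ∷ [] ]
insertions x (y ∷ ys) = (x ∷ y ∷ ys) ∷ map (y ∷_) (insertions x ys)

perms : {A : Set} → List A → List (List A)
perms []       = [ [] ]
perms (x ∷ xs) = concatMap (insertions x) (perms xs)

-- Finite formal sums with natural coefficients: lists (multiplicity = coefficient).
-- Result of firing the redex ⟨λx.t⟩[s₁,…,sₙ]
redex : RTerm → List RTerm → List RTerm
redex t bs = if occ 0 t ≡ᵇ length bs
             then map (λ σ → proj₁ (lsub 0 t σ)) (perms bs)
             else []

infix 4 _⟶_
data _⟶_ : RTerm → List RTerm → Set where
  ⟶β    : ∀ {t bs} → rapp (rlam t) bs ⟶ redex t bs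
  ⟶lam  : ∀ {s a} → s ⟶ a → rlam s ⟶ map rlam a
  ⟶appL : ∀ {s a bs} → s ⟶ a → rapp s bs ⟶ map (λ u → rapp u bs) a
  ⟶appR : ∀ {s a u xs ys} → s ⟶ a →
          rapp u (xs ++ s ∷ ys) ⟶ map (λ v → rapp u (xs ++ v ∷ ys)) a

infix 4 _⟶Σ_
data _⟶Σ_ : List RTerm → List RTerm → Set where
  step : ∀ {xs s a ys} → s ⟶ a → (xs ++ s ∷ ys) ⟶Σ (xs ++ a ++ ys)

_⟶Σ*_ : List RTerm → List RTerm → Set
_⟶Σ*_ = Star _⟶Σ_

_∈supp_ : RTerm → List RTerm → Set
t ∈supp a = Any (t ≈ᵣ_) a

infix 4 _≥ᵣ_ _>ᵣ_
_≥ᵣ_ : RTerm → RTerm → Set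
s ≥ᵣ t = ∃[ a ] ((s ∷ []) ⟶Σ* a × t ∈supp a)

_>ᵣ_ : RTerm → RTerm → Set
s >ᵣ t = s ≥ᵣ t × ¬ (s ≈ᵣ t)

infix 4 _∈T_
data _∈T_ : RTerm → Term → Set where
  T-var : ∀ {i} → rvar i ∈T var i
  T-lam : ∀ {s M} → s ∈T M → rlam s ∈T lam M
  T-app : ∀ {s bs M N} → s ∈T M → All (_∈T N) bs → rapp s bs ∈T app M N
  T-⊕L  : ∀ {s M N} → s ∈T M → s ∈T M ⊕ N
  T-⊕R  : ∀ {s M N} → s ∈T N → s ∈T M ⊕ N

-- The Taylor support is invariant under ≃ and monotone for ⊑, so it suffices to
-- reflect a single raw β-step.  For
-- a redex (λx.M)N, every t ∈ T(M[N/x]) is obtained from some s ∈ T(M) by linearly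
-- substituting a bag ū ∈ T(N)^! whose size is the number of occurrences of x in s;
-- then ⟨λx.s⟩ū ∈ T((λx.M)N) fires to a sum containing t, and it is strictly larger
-- than t, which makes a top-level step strict.
module Submission where

open import Defs
open import Data.Bool using (true; false)
open import Relation.Nullary using (¬_)
open import Data.List using (List; []; _∷_; _++_; map; length; [_]; concatMap)
open import Data.List.Membership.Propositional using (_∈_)
open import Data.List.Membership.Propositional.Properties using (∈-map⁺; ∈-++⁺ˡ; ∈-++⁺ʳ; ∈-∃++)
open import Data.List.Properties using (map-++; ++-assoc; ++-identityʳ; length-++)
open import Data.List.Relation.Binary.Pointwise using (Pointwise; []; _∷_)
open import Data.List.Relation.Unary.All using (All; []; _∷_)
import Data.List.Relation.Unary.All as All
open import Data.List.Relation.Unary.All.Properties using (++⁺)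
open import Data.List.Relation.Unary.Any using (here; there)
import Data.List.Relation.Unary.Any as Any
open import Data.Nat using (ℕ; zero; suc; pred; _+_; _≡ᵇ_; _<ᵇ_; _≤ᵇ_; _<_; s≤s)
open import Data.Nat.Properties
  using (+-assoc; +-comm; +-identityʳ; m≤m+n; n≤1+n; <-irrefl; module ≤-Reasoning; +-commutativeSemigroup)
open import Algebra.Properties.CommutativeSemigroup +-commutativeSemigroup using (interchange; x∙yz≈y∙xz)
open import Data.Product using (_×_; _,_; proj₁; ∃-syntax)
open import Relation.Binary.Construct.Closure.ReflexiveTransitive using (ε; _◅_; _◅◅_; gmap)
open import Relation.Binary.PropositionalEquality
  using (_≡_; refl; sym; trans; cong; cong₂; subst₂; module ≡-Reasoning)
  renaming (subst to transport)

mutual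
  ≃-preserves-∈T : ∀ {M N s} → M ≃ N → s ∈T M → s ∈T N
  ≃-preserves-∈T ≃-refl d = d
  ≃-preserves-∈T (≃-sym e) d = ≃-reflects-∈T e d
  ≃-preserves-∈T (≃-trans e f) d = ≃-preserves-∈T f (≃-preserves-∈T e d)
  ≃-preserves-∈T (≃-lam e) (T-lam d) = T-lam (≃-preserves-∈T e d)
  ≃-preserves-∈T (≃-appL e) (T-app d ds) = T-app (≃-preserves-∈T e d) ds
  ≃-preserves-∈T (≃-appR e) (T-app d ds) = T-app d (All.map (≃-preserves-∈T e) ds)
  ≃-preserves-∈T (≃-⊕L e) (T-⊕L d) = T-⊕L (≃-preserves-∈T e d)
  ≃-preserves-∈T (≃-⊕L e) (T-⊕R d) = T-⊕R d
  ≃-preserves-∈T (≃-⊕R e) (T-⊕L d) = T-⊕L d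
  ≃-preserves-∈T (≃-⊕R e) (T-⊕R d) = T-⊕R (≃-preserves-∈T e d)
  ≃-preserves-∈T ≃-comm (T-⊕L d) = T-⊕R d
  ≃-preserves-∈T ≃-comm (T-⊕R d) = T-⊕L d
  ≃-preserves-∈T ≃-assoc (T-⊕L (T-⊕L d)) = T-⊕L d
  ≃-preserves-∈T ≃-assoc (T-⊕L (T-⊕R d)) = T-⊕R (T-⊕L d)
  ≃-preserves-∈T ≃-assoc (T-⊕R d) = T-⊕R (T-⊕R d)
  ≃-preserves-∈T ≃-lam⊕ (T-lam (T-⊕L d)) = T-⊕L (T-lam d)
  ≃-preserves-∈T ≃-lam⊕ (T-lam (T-⊕R d)) = T-⊕R (T-lam d)
  ≃-preserves-∈T ≃-app⊕ (T-app (T-⊕L d) ds) = T-⊕L (T-app d ds)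
  ≃-preserves-∈T ≃-app⊕ (T-app (T-⊕R d) ds) = T-⊕R (T-app d ds)

  ≃-reflects-∈T : ∀ {M N s} → M ≃ N → s ∈T N → s ∈T M
  ≃-reflects-∈T ≃-refl d = d
  ≃-reflects-∈T (≃-sym e) d = ≃-preserves-∈T e d
  ≃-reflects-∈T (≃-trans e f) d = ≃-reflects-∈T e (≃-reflects-∈T f d)
  ≃-reflects-∈T (≃-lam e) (T-lam d) = T-lam (≃-reflects-∈T e d)
  ≃-reflects-∈T (≃-appL e) (T-app d ds) = T-app (≃-reflects-∈T e d) ds
  ≃-reflects-∈T (≃-appR e) (T-app d ds) = T-app d (All.map (≃-reflects-∈T e) ds)
  ≃-reflects-∈T (≃-⊕L e) (T-⊕L d) = T-⊕L (≃-reflects-∈T e d)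
  ≃-reflects-∈T (≃-⊕L e) (T-⊕R d) = T-⊕R d
  ≃-reflects-∈T (≃-⊕R e) (T-⊕L d) = T-⊕L d
  ≃-reflects-∈T (≃-⊕R e) (T-⊕R d) = T-⊕R (≃-reflects-∈T e d)
  ≃-reflects-∈T ≃-comm (T-⊕L d) = T-⊕R d
  ≃-reflects-∈T ≃-comm (T-⊕R d) = T-⊕L d
  ≃-reflects-∈T ≃-assoc (T-⊕L d) = T-⊕L (T-⊕L d)
  ≃-reflects-∈T ≃-assoc (T-⊕R (T-⊕L d)) = T-⊕L (T-⊕R d)
  ≃-reflects-∈T ≃-assoc (T-⊕R (T-⊕R d)) = T-⊕R d
  ≃-reflects-∈T ≃-lam⊕ (T-⊕L (T-lam d)) = T-lam (T-⊕L d)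
  ≃-reflects-∈T ≃-lam⊕ (T-⊕R (T-lam d)) = T-lam (T-⊕R d)
  ≃-reflects-∈T ≃-app⊕ (T-⊕L (T-app d ds)) = T-app (T-⊕L d) ds
  ≃-reflects-∈T ≃-app⊕ (T-⊕R (T-app d ds)) = T-app (T-⊕R d) ds

⊑-preserves-∈T : ∀ {M N s} → M ⊑ N → s ∈T M → s ∈T N
⊑-preserves-∈T (⊑-≃ e) d = ≃-preserves-∈T e d
⊑-preserves-∈T (⊑-trans p q) d = ⊑-preserves-∈T q (⊑-preserves-∈T p d)
⊑-preserves-∈T ⊑-inl d = T-⊕L d
⊑-preserves-∈T ⊑-inr d = T-⊕R d
⊑-preserves-∈T (⊑-⊕ p) (T-⊕L d) = T-⊕L (⊑-preserves-∈T p d)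
⊑-preserves-∈T (⊑-⊕ p) (T-⊕R d) = T-⊕R d
⊑-preserves-∈T (⊑-lam p) (T-lam d) = T-lam (⊑-preserves-∈T p d)
⊑-preserves-∈T (⊑-appL p) (T-app d ds) = T-app (⊑-preserves-∈T p d) ds
⊑-preserves-∈T (⊑-appR p) (T-app d ds) = T-app d (All.map (⊑-preserves-∈T p) ds)

mutual
  size : RTerm → ℕ
  size (rvar i) = 1
  size (rlam s) = suc (size s)
  size (rapp s bs) = suc (size s + sizeB bs)

  sizeB : List RTerm → ℕ
  sizeB [] = 0
  sizeB (b ∷ bs) = size b + sizeB bs

sizeB-++ : ∀ xs ys → sizeB (xs ++ ys) ≡ sizeB xs + sizeB ys
sizeB-++ [] ys = refl
sizeB-++ (x ∷ xs) ys = trans (cong (size x +_) (sizeB-++ xs ys)) (sym (+-assoc (size x) _ _))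

sizeB-insert : ∀ xs y zs → sizeB (xs ++ y ∷ zs) ≡ size y + sizeB (xs ++ zs)
sizeB-insert xs y zs = begin
  sizeB (xs ++ y ∷ zs)          ≡⟨ sizeB-++ xs (y ∷ zs) ⟩
  sizeB xs + (size y + sizeB zs) ≡⟨ x∙yz≈y∙xz (sizeB xs) (size y) (sizeB zs) ⟩
  size y + (sizeB xs + sizeB zs) ≡⟨ cong (size y +_) (sym (sizeB-++ xs zs)) ⟩
  size y + sizeB (xs ++ zs)      ∎
  where open ≡-Reasoning

mutual
  size-≈ᵣ : ∀ {s t} → s ≈ᵣ t → size s ≡ size t
  size-≈ᵣ rvar = refl
  size-≈ᵣ (rlam e) = cong suc (size-≈ᵣ e)
  size-≈ᵣ (rapp e es) = cong suc (cong₂ _+_ (size-≈ᵣ e) (sizeB-≈b es))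

  sizeB-≈b : ∀ {bs cs} → bs ≈b cs → sizeB bs ≡ sizeB cs
  sizeB-≈b [] = refl
  sizeB-≈b (_∷_ {ys₁ = ys₁} {ys₂} e es) =
    trans (cong₂ _+_ (size-≈ᵣ e) (sizeB-≈b es)) (sym (sizeB-insert ys₁ _ ys₂))

mutual
  size-rshift : ∀ c s → size (rshift c s) ≡ size s
  size-rshift c (rvar i) with c ≤ᵇ i
  ... | true = refl
  ... | false = refl
  size-rshift c (rlam s) = cong suc (size-rshift (suc c) s)
  size-rshift c (rapp s bs) = cong suc (cong₂ _+_ (size-rshift c s) (sizeB-rshiftB c bs))

  sizeB-rshiftB : ∀ c bs → sizeB (rshiftB c bs) ≡ sizeB bs
  sizeB-rshiftB c [] = refl
  sizeB-rshiftB c (b ∷ bs) = cong₂ _+_ (size-rshift c b) (sizeB-rshiftB c bs)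

size-rshiftN : ∀ k s → size (rshiftN k s) ≡ size s
size-rshiftN zero s = refl
size-rshiftN (suc k) s = trans (size-rshift 0 (rshiftN k s)) (size-rshiftN k s)

mutual
  ∈T-shift⁻¹ : ∀ c M {t} → t ∈T shift c M → ∃[ u ] (u ∈T M × rshift c u ≡ t)
  ∈T-shift⁻¹ c (var i) d with c ≤ᵇ i in eq
  ∈T-shift⁻¹ c (var i) T-var | true = rvar i , T-var , shifted
    where
      shifted : rshift c (rvar i) ≡ rvar (suc i)
      shifted rewrite eq = refl
  ∈T-shift⁻¹ c (var i) T-var | false = rvar i , T-var , unshifted
    where
      unshifted : rshift c (rvar i) ≡ rvar i
      unshifted rewrite eq = refl
  ∈T-shift⁻¹ c (lam M) (T-lam d) with ∈T-shift⁻¹ (suc c) M d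
  ... | u , du , refl = rlam u , T-lam du , refl
  ∈T-shift⁻¹ c (app M N) (T-app d ds) with ∈T-shift⁻¹ c M d | ∈T-shiftB⁻¹ c N ds
  ... | u , du , refl | us , dus , refl = rapp u us , T-app du dus , refl
  ∈T-shift⁻¹ c (M ⊕ N) (T-⊕L d) with ∈T-shift⁻¹ c M d
  ... | u , du , e = u , T-⊕L du , e
  ∈T-shift⁻¹ c (M ⊕ N) (T-⊕R d) with ∈T-shift⁻¹ c N d
  ... | u , du , e = u , T-⊕R du , e

  ∈T-shiftB⁻¹ : ∀ c N {bs} → All (_∈T shift c N) bs → ∃[ us ] (All (_∈T N) us × rshiftB c us ≡ bs)
  ∈T-shiftB⁻¹ c N [] = [] , [] , refl
  ∈T-shiftB⁻¹ c N (d ∷ ds) with ∈T-shift⁻¹ c N d | ∈T-shiftB⁻¹ c N ds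
  ... | u , du , refl | us , dus , refl = u ∷ us , du ∷ dus , refl

∈T-shiftN⁻¹ : ∀ k M {t} → t ∈T shiftN k M → ∃[ u ] (u ∈T M × rshiftN k u ≡ t)
∈T-shiftN⁻¹ zero M d = _ , d , refl
∈T-shiftN⁻¹ (suc k) M d with ∈T-shift⁻¹ 0 (shiftN k M) d
... | u' , du' , refl with ∈T-shiftN⁻¹ k M du'
... | u , du , refl = u , du , refl

-- t ∈ T(M[N/x]) arises from s ∈ T(M) by linearly substituting a bag ū ∈ T(N)^!
-- for the occurrences of x; `extra` is the unconsumed tail of the input list.  The
-- size equation holds because each occurrence of x, of size 1, becomes one element of ū.
record SubstPreimage (k : ℕ) (N M : Term) (t : RTerm) : Set where
  field
    body      : RTerm
    bag       : List RTerm
    body∈T    : body ∈T M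
    bag∈T     : All (_∈T N) bag
    occ-body  : occ k body ≡ length bag
    lsub-body : ∀ extra → lsub k body (bag ++ extra) ≡ (t , extra)
    size-body : size t + length bag ≡ size body + sizeB bag

record SubstPreimageB (k : ℕ) (N M : Term) (ts : List RTerm) : Set where
  field
    bodies      : List RTerm
    bag         : List RTerm
    bodies∈T    : All (_∈T M) bodies
    bag∈T       : All (_∈T N) bag
    occ-bodies  : occB k bodies ≡ length bag
    lsub-bodies : ∀ extra → lsubB k bodies (bag ++ extra) ≡ (ts , extra)
    size-bodies : sizeB ts + length bag ≡ sizeB bodies + sizeB bag

size-++-split : ∀ {a b sa sb} us vs → a + length us ≡ sa + sizeB us → b + length vs ≡ sb + sizeB vs →
                (a + b) + length (us ++ vs) ≡ (sa + sb) + sizeB (us ++ vs)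
size-++-split {a} {b} {sa} {sb} us vs e f = begin
  (a + b) + length (us ++ vs)                ≡⟨ cong ((a + b) +_) (length-++ us) ⟩
  (a + b) + (length us + length vs)          ≡⟨ interchange a b (length us) (length vs) ⟩
  (a + length us) + (b + length vs)          ≡⟨ cong₂ _+_ e f ⟩
  (sa + sizeB us) + (sb + sizeB vs)          ≡⟨ interchange sa (sizeB us) sb (sizeB vs) ⟩
  (sa + sb) + (sizeB us + sizeB vs)          ≡⟨ cong ((sa + sb) +_) (sym (sizeB-++ us vs)) ⟩
  (sa + sb) + sizeB (us ++ vs)               ∎
  where open ≡-Reasoning

mutual
  ∈T-subst⁻¹ : ∀ k N M {t} → t ∈T subst k N M → SubstPreimage k N M t
  ∈T-subst⁻¹ k N (var i) d with i ≡ᵇ k in hit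
  ... | true with ∈T-shiftN⁻¹ k N d
  ...   | u , du , refl = record
          { body = rvar i ; bag = u ∷ [] ; body∈T = T-var ; bag∈T = du ∷ [] ; occ-body = once ; lsub-body = consume
          ; size-body = trans (cong (_+ 1) (size-rshiftN k u))
                                    (trans (+-comm (size u) 1) (cong suc (sym (+-identityʳ (size u))))) }
    where
      once : occ k (rvar i) ≡ 1
      once rewrite hit = refl
      consume : ∀ extra → lsub k (rvar i) (u ∷ extra) ≡ (rshiftN k u , extra)
      consume extra rewrite hit = refl
  ∈T-subst⁻¹ k N (var i) d | false with i <ᵇ k in below
  ∈T-subst⁻¹ k N (var i) T-var | false | true = record
    { body = rvar i ; bag = [] ; body∈T = T-var ; bag∈T = [] ; occ-body = never ; lsub-body = keep ; size-body = refl }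
    where
      never : occ k (rvar i) ≡ 0
      never rewrite hit = refl
      keep : ∀ extra → lsub k (rvar i) extra ≡ (rvar i , extra)
      keep extra rewrite hit | below = refl
  ∈T-subst⁻¹ k N (var i) T-var | false | false = record
    { body = rvar i ; bag = [] ; body∈T = T-var ; bag∈T = [] ; occ-body = never ; lsub-body = lower ; size-body = refl }
    where
      never : occ k (rvar i) ≡ 0
      never rewrite hit = refl
      lower : ∀ extra → lsub k (rvar i) extra ≡ (rvar (pred i) , extra)
      lower extra rewrite hit | below = refl
  ∈T-subst⁻¹ k N (lam M) (T-lam d) = record
    { body = rlam body ; bag = bag ; body∈T = T-lam body∈T ; bag∈T = bag∈T ; occ-body = occ-body
    ; lsub-body = under-λ ; size-body = cong suc size-body }
    where
      open SubstPreimage (∈T-subst⁻¹ (suc k) N M d)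
      under-λ : ∀ extra → lsub k (rlam body) (bag ++ extra) ≡ (_ , extra)
      under-λ extra rewrite lsub-body extra = refl
  ∈T-subst⁻¹ k N (app M P) (T-app {s = t} {bs = ts} d ds) = record
    { body = rapp F.body A.bodies ; bag = F.bag ++ A.bag ; body∈T = T-app F.body∈T A.bodies∈T ; bag∈T = ++⁺ F.bag∈T A.bag∈T
    ; occ-body = trans (cong₂ _+_ F.occ-body A.occ-bodies) (sym (length-++ F.bag))
    ; lsub-body = in-app
    ; size-body = cong suc (size-++-split F.bag A.bag F.size-body A.size-bodies) }
    where
      module F = SubstPreimage (∈T-subst⁻¹ k N M d)
      module A = SubstPreimageB (∈T-substB⁻¹ k N P ds)
      in-app : ∀ extra → lsub k (rapp F.body A.bodies) ((F.bag ++ A.bag) ++ extra) ≡ (rapp t ts , extra)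
      in-app extra rewrite ++-assoc F.bag A.bag extra | F.lsub-body (A.bag ++ extra) | A.lsub-bodies extra = refl
  ∈T-subst⁻¹ k N (M ⊕ P) (T-⊕L d) = record { SubstPreimage (∈T-subst⁻¹ k N M d) ; body∈T = T-⊕L body∈T }
    where open SubstPreimage (∈T-subst⁻¹ k N M d)
  ∈T-subst⁻¹ k N (M ⊕ P) (T-⊕R d) = record { SubstPreimage (∈T-subst⁻¹ k N P d) ; body∈T = T-⊕R body∈T }
    where open SubstPreimage (∈T-subst⁻¹ k N P d)

  ∈T-substB⁻¹ : ∀ k N P {ts} → All (_∈T subst k N P) ts → SubstPreimageB k N P ts
  ∈T-substB⁻¹ k N P [] = record
    { bodies = [] ; bag = [] ; bodies∈T = [] ; bag∈T = [] ; occ-bodies = refl ; lsub-bodies = λ _ → refl ; size-bodies = refl }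
  ∈T-substB⁻¹ k N P (_∷_ {x = t} {xs = ts} d ds) = record
    { bodies = H.body ∷ T.bodies ; bag = H.bag ++ T.bag ; bodies∈T = H.body∈T ∷ T.bodies∈T ; bag∈T = ++⁺ H.bag∈T T.bag∈T
    ; occ-bodies = trans (cong₂ _+_ H.occ-body T.occ-bodies) (sym (length-++ H.bag))
    ; lsub-bodies = in-bag
    ; size-bodies = size-++-split H.bag T.bag H.size-body T.size-bodies }
    where
      module H = SubstPreimage (∈T-subst⁻¹ k N P d)
      module T = SubstPreimageB (∈T-substB⁻¹ k N P ds)
      in-bag : ∀ extra → lsubB k (H.body ∷ T.bodies) ((H.bag ++ T.bag) ++ extra) ≡ (t ∷ ts , extra)
      in-bag extra rewrite ++-assoc H.bag T.bag extra | H.lsub-body (T.bag ++ extra) | T.lsub-bodies extra = refl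

infix 4 _↠_
_↠_ : RTerm → RTerm → Set
s ↠ t = ∃[ a ] ((s ∷ []) ⟶Σ* a × t ∈ a)

↠-refl : ∀ {s} → s ↠ s
↠-refl = _ , ε , here refl

⟶Σ-frame : ∀ pre post {xs ys} → xs ⟶Σ ys → (pre ++ xs ++ post) ⟶Σ (pre ++ ys ++ post)
⟶Σ-frame pre post (step {xs = as} {s} {a} {bs} r) =
  subst₂ _⟶Σ_ (sym redex-split) (sym reduct-split) (step {xs = pre ++ as} {ys = bs ++ post} r)
  where
    open ≡-Reasoning
    redex-split : pre ++ (as ++ s ∷ bs) ++ post ≡ (pre ++ as) ++ s ∷ (bs ++ post)
    redex-split = begin
      pre ++ (as ++ s ∷ bs) ++ post   ≡⟨ cong (pre ++_) (++-assoc as (s ∷ bs) post) ⟩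
      pre ++ as ++ s ∷ bs ++ post     ≡⟨ ++-assoc pre as (s ∷ bs ++ post) ⟨
      (pre ++ as) ++ s ∷ (bs ++ post) ∎
    reduct-split : pre ++ (as ++ a ++ bs) ++ post ≡ (pre ++ as) ++ a ++ (bs ++ post)
    reduct-split = begin
      pre ++ (as ++ a ++ bs) ++ post   ≡⟨ cong (pre ++_) (++-assoc as (a ++ bs) post) ⟩
      pre ++ as ++ (a ++ bs) ++ post   ≡⟨ cong (λ z → pre ++ as ++ z) (++-assoc a bs post) ⟩
      pre ++ as ++ a ++ bs ++ post     ≡⟨ ++-assoc pre as (a ++ bs ++ post) ⟨
      (pre ++ as) ++ a ++ (bs ++ post) ∎

↠-trans : ∀ {s t r} → s ↠ t → t ↠ r → s ↠ r
↠-trans (a , s⟶a , t∈a) (b , t⟶b , r∈b) with ∈-∃++ t∈a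
... | xs , ys , refl = xs ++ b ++ ys , s⟶a ◅◅ gmap (λ c → xs ++ c ++ ys) (⟶Σ-frame xs ys) t⟶b
                     , ∈-++⁺ʳ xs (∈-++⁺ˡ r∈b)

module _ (C : RTerm → RTerm) (C-⟶ : ∀ {s a} → s ⟶ a → C s ⟶ map C a) where

  ⟶Σ-cong : ∀ {xs ys} → xs ⟶Σ ys → map C xs ⟶Σ map C ys
  ⟶Σ-cong (step {xs = as} {s} {a} {bs} r) =
    subst₂ _⟶Σ_ (sym (map-++ C as (s ∷ bs)))
      (sym (trans (map-++ C as (a ++ bs)) (cong (map C as ++_) (map-++ C a bs))))
      (step {xs = map C as} {ys = map C bs} (C-⟶ r))

  ↠-cong : ∀ {s t} → s ↠ t → C s ↠ C t
  ↠-cong (a , s⟶a , t∈a) = map C a , gmap (map C) ⟶Σ-cong s⟶a , ∈-map⁺ C t∈a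

↠-bag : ∀ u pre {ss ts} → Pointwise _↠_ ss ts → rapp u (pre ++ ss) ↠ rapp u (pre ++ ts)
↠-bag u pre [] = ↠-refl
↠-bag u pre (_∷_ {x = s} {y = t} {xs = ss} {ys = ts} s↠t ss↠ts) =
  ↠-trans (↠-cong (λ v → rapp u (pre ++ v ∷ ss)) ⟶appR s↠t)
          (subst₂ _↠_ (cong (rapp u) (++-assoc pre [ t ] ss)) (cong (rapp u) (++-assoc pre [ t ] ts))
                  (↠-bag u (pre ++ [ t ]) ss↠ts))

∈-perms : ∀ {A : Set} (xs : List A) → xs ∈ perms xs
∈-perms [] = here refl
∈-perms {A} (x ∷ xs) = ∈-concatMap (∈-perms xs)
  where
    ∈-insertions : ∀ ys → (x ∷ ys) ∈ insertions x ys
    ∈-insertions [] = here refl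
    ∈-insertions (y ∷ ys) = here refl
    ∈-concatMap : ∀ {L : List (List A)} → xs ∈ L → (x ∷ xs) ∈ concatMap (insertions x) L
    ∈-concatMap {z ∷ zs} (here refl) = ∈-++⁺ˡ (∈-insertions xs)
    ∈-concatMap {z ∷ zs} (there p) = ∈-++⁺ʳ (insertions x z) (∈-concatMap p)

≡ᵇ-refl : ∀ n → (n ≡ᵇ n) ≡ true
≡ᵇ-refl zero = refl
≡ᵇ-refl (suc n) = ≡ᵇ-refl n

-- Firing ⟨λx.s⟩ū with the identity permutation yields t.
β-expansion : ∀ {M N t} → SubstPreimage 0 N M t →
              ∃[ S ] (S ∈T app (lam M) N × S ↠ t × size t < size S)
β-expansion {M} {N} {t} p =
  rapp (rlam body) bag , T-app (T-lam body∈T) bag∈T ,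
  (redex body bag ++ [] , step {xs = []} {ys = []} ⟶β ◅ ε , ∈-++⁺ˡ t∈redex) , shrinks
  where
    open SubstPreimage p
    fire : List RTerm → RTerm
    fire σ = proj₁ (lsub 0 body σ)
    fire-bag : fire bag ≡ t
    fire-bag = cong proj₁ (transport (λ z → lsub 0 body z ≡ (t , [])) (++-identityʳ bag) (lsub-body []))
    t∈redex : t ∈ redex body bag
    t∈redex rewrite occ-body | ≡ᵇ-refl (length bag) =
      transport (_∈ map fire (perms bag)) fire-bag (∈-map⁺ fire (∈-perms bag))
    shrinks : size t < size (rapp (rlam body) bag)
    shrinks = s≤s (begin
      size t                     ≤⟨ m≤m+n (size t) (length bag) ⟩
      size t + length bag        ≡⟨ size-body ⟩
      size body + sizeB bag      ≤⟨ n≤1+n _ ⟩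
      suc (size body + sizeB bag) ∎)
      where open ≤-Reasoning

mutual
  →β₀-reflects-∈T : ∀ {M N t} → M →β₀ N → t ∈T N → ∃[ s ] (s ∈T M × s ↠ t)
  →β₀-reflects-∈T {app (lam M) N} β d with β-expansion (∈T-subst⁻¹ 0 N M d)
  ... | S , S∈T , S↠t , _ = S , S∈T , S↠t
  →β₀-reflects-∈T (ξ-lam r) (T-lam d) with →β₀-reflects-∈T r d
  ... | s , s∈T , s↠t = rlam s , T-lam s∈T , ↠-cong rlam ⟶lam s↠t
  →β₀-reflects-∈T (ξ-appL r) (T-app {bs = bs} d ds) with →β₀-reflects-∈T r d
  ... | s , s∈T , s↠t = rapp s bs , T-app s∈T ds , ↠-cong (λ u → rapp u bs) ⟶appL s↠t
  →β₀-reflects-∈T (ξ-appR r) (T-app {s = u} d ds) with →β₀-reflects-All-∈T r ds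
  ... | ss , ss∈T , ss↠ts = rapp u ss , T-app d ss∈T , ↠-bag u [] ss↠ts
  →β₀-reflects-∈T (ξ-⊕L r) (T-⊕L d) with →β₀-reflects-∈T r d
  ... | s , s∈T , s↠t = s , T-⊕L s∈T , s↠t
  →β₀-reflects-∈T (ξ-⊕L r) (T-⊕R d) = _ , T-⊕R d , ↠-refl
  →β₀-reflects-∈T (ξ-⊕R r) (T-⊕L d) = _ , T-⊕L d , ↠-refl
  →β₀-reflects-∈T (ξ-⊕R r) (T-⊕R d) with →β₀-reflects-∈T r d
  ... | s , s∈T , s↠t = s , T-⊕R s∈T , s↠t

  →β₀-reflects-All-∈T : ∀ {M N ts} → M →β₀ N → All (_∈T N) ts →
                        ∃[ ss ] (All (_∈T M) ss × Pointwise _↠_ ss ts)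
  →β₀-reflects-All-∈T r [] = [] , [] , []
  →β₀-reflects-All-∈T r (d ∷ ds) with →β₀-reflects-∈T r d | →β₀-reflects-All-∈T r ds
  ... | s , s∈T , s↠t | ss , ss∈T , ss↠ts = s ∷ ss , s∈T ∷ ss∈T , s↠t ∷ ss↠ts

mutual
  ≈ᵣ-refl : ∀ {s} → s ≈ᵣ s
  ≈ᵣ-refl {rvar i} = rvar
  ≈ᵣ-refl {rlam s} = rlam ≈ᵣ-refl
  ≈ᵣ-refl {rapp s bs} = rapp ≈ᵣ-refl ≈b-refl

  ≈b-refl : ∀ {bs} → bs ≈b bs
  ≈b-refl {[]} = []
  ≈b-refl {b ∷ bs} = _∷_ {ys₁ = []} ≈ᵣ-refl ≈b-refl

↠⇒≥ᵣ : ∀ {s t} → s ↠ t → s ≥ᵣ t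
↠⇒≥ᵣ (a , s⟶a , t∈a) = a , s⟶a , Any.map (λ { refl → ≈ᵣ-refl }) t∈a

<-size⇒≉ᵣ : ∀ {s t} → size t < size s → ¬ (s ≈ᵣ t)
<-size⇒≉ᵣ t<s s≈t = <-irrefl (sym (size-≈ᵣ s≈t)) t<s

lemma4 : (M N : Term) → M ⇝ N → (t : RTerm) → t ∈T N →
         (∃[ s ] (s ∈T M × s ≥ᵣ t)) × (TopLevel M N → ∃[ s ] (s ∈T M × s >ᵣ t))
lemma4 M N (P , (M₁ , P₁ , M≃M₁ , M₁→P₁ , P₁≃P) , N⊑P) t t∈N = weak , strict
  where
    weak : ∃[ s ] (s ∈T M × s ≥ᵣ t)
    weak with →β₀-reflects-∈T M₁→P₁ (≃-reflects-∈T P₁≃P (⊑-preserves-∈T N⊑P t∈N))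
    ... | s , s∈M₁ , s↠t = s , ≃-reflects-∈T M≃M₁ s∈M₁ , ↠⇒≥ᵣ s↠t

    strict : TopLevel M N → ∃[ s ] (s ∈T M × s >ᵣ t)
    strict (M' , M'' , M≃redex , N⊑contractum)
      with β-expansion (∈T-subst⁻¹ 0 M'' M' (⊑-preserves-∈T N⊑contractum t∈N))
    ... | S , S∈redex , S↠t , t<S = S , ≃-reflects-∈T M≃redex S∈redex , ↠⇒≥ᵣ S↠t , <-size⇒≉ᵣ t<S
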